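{- (1) Compatibility: if $t\precsim_{type}t'$ then $C\langle t\rangle\precsim_{type}C\langle t'\rangle$ for every context $C$. (2) Soundness: if $t\precsim_{type}t'$ then $t\precsim_Ct'$.
   Context: VSC terms $t::=v\mid tu\mid t[x\leftarrow u]$, values $v::=x\mid\lambda x.t$; contexts $C::=\langle\cdot\rangle\mid tC\mid Ct\mid\lambda x.C\mid C[x\leftarrow t]\mid t[x\leftarrow C]$. Reduction $\to_{vsc}$: closure under evaluation contexts $E::=\langle\cdot\rangle\mid tE\mid Et\mid E[x\leftarrow u]\mid t[x\leftarrow E]$ of $L\langle\lambda x.t\rangle u\mapsto L\langle t[x\leftarrow u]\rangle$ and $t[x\leftarrow L\langle v\rangle]\mapsto L\langle t\{x:=v\}\rangle$, where $L::=\langle\cdot\rangle\mid L[x\leftarrow t]$. Contextual preorder: $t\precsim_Cu$ iff for every context $C$ with $C\langle t\rangle, C\langle u\rangle$ closed, if $C\langle t\rangle$ has a $\to_{vsc}$-normal form then so does $C\langle u\rangle$. Multi types: linear $L::=M\multimap N$; multi $M,N::=[L_1,\dots,L_n]$ (finite multisets, $n\ge0$, union $\uplus$); typing contexts assign multi types to finitely many variables, $\uplus$ pointwise. Rules: $x:[L]\vdash x:L$; $\Gamma,x:M\vdash t:N\Rightarrow\Gamma\vdash\lambda x.t:M\multimap N$; $(\Gamma_i\vdash v:L_i)_{i\in I}$, $I$ finite $\Rightarrow\uplus_i\Gamma_i\vdash v:\uplus_i[L_i]$; $\Gamma\vdash t:[M\multimap N]$, $\Delta\vdash u:M\Rightarrow\Gamma\uplus\Delta\vdash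 tu:N$; $\Gamma,x:M\vdash t:N$, $\Delta\vdash u:M\Rightarrow\Gamma\uplus\Delta\vdash t[x\leftarrow u]:N$. Type preorder: $t\precsim_{type}t'$ iff for all $\Gamma$ and multi types $M$, derivability of $\Gamma\vdash t:M$ implies derivability of $\Gamma\vdash t':M$. -}

module Defs where

open import Data.Nat using (ℕ; zero; suc)
open import Data.Fin using (Fin; zero; suc; _≟_)
open import Data.List using (List; []; _∷_; _++_)
open import Data.Product using (Σ; ∃; _×_; _,_)
open import Relation.Nullary using (¬_; yes; no)
open import Relation.Binary.Construct.Closure.ReflexiveTransitive using (Star)

-- VSC terms, well-scoped de Bruijn syntax.
-- Term n : terms whose free variables are among n variables.
-- es t u  represents  t[x ← u]  (x = de Bruijn index 0 in t).

data Term (n : ℕ) : Set where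
  var : Fin n → Term n
  lam : Term (suc n) → Term n
  app : Term n → Term n → Term n
  es  : Term (suc n) → Term n → Term n

data IsValue {n : ℕ} : Term n → Set where
  var : (x : Fin n) → IsValue (var x)
  lam : (t : Term (suc n)) → IsValue (lam t)

lift : {n m : ℕ} → (Fin n → Fin m) → Fin (suc n) → Fin (suc m)
lift ρ zero    = zero
lift ρ (suc i) = suc (ρ i)

rename : {n m : ℕ} → (Fin n → Fin m) → Term n → Term m
rename ρ (var x)  = var (ρ x)
rename ρ (lam t)  = lam (rename (lift ρ) t)
rename ρ (app t u) = app (rename ρ t) (rename ρ u)
rename ρ (es t u) = es (rename (lift ρ) t) (rename ρ u)

liftS : {n m : ℕ} → (Fin n → Term m) → Fin (suc n) → Term (suc m)
liftS σ zero    = var zero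
liftS σ (suc i) = rename suc (σ i)

subst : {n m : ℕ} → (Fin n → Term m) → Term n → Term m
subst σ (var x)   = σ x
subst σ (lam t)   = lam (subst (liftS σ) t)
subst σ (app t u) = app (subst σ t) (subst σ u)
subst σ (es t u)  = es (subst (liftS σ) t) (subst σ u)

sub0 : {n : ℕ} → Term n → Fin (suc n) → Term n
sub0 v zero    = v
sub0 v (suc i) = var i

_[0:=_] : {n : ℕ} → Term (suc n) → Term n → Term n
t [0:= v ] = subst (sub0 v) t

-- Substitution contexts  L ::= ⟨·⟩ | L[x ← t]
-- LCtx n m : outer scope n, hole scope m.

data LCtx : ℕ → ℕ → Set where
  hole : {n : ℕ} → LCtx n n
  esL  : {n m : ℕ} → LCtx (suc n) m → Term n → LCtx n m

plugL : {n m : ℕ} → LCtx n m → Term m → Term n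
plugL hole      s = s
plugL (esL L t) s = es (plugL L s) t

wkL : {n m : ℕ} → LCtx n m → Fin n → Fin m
wkL hole      i = i
wkL (esL L t) i = wkL L (suc i)

data _↦_ {n : ℕ} : Term n → Term n → Set where
  dB : {m : ℕ} (L : LCtx n m) (t : Term (suc m)) (u : Term n) →
       app (plugL L (lam t)) u ↦ plugL L (es t (rename (wkL L) u))
  ls : {m : ℕ} (t : Term (suc n)) (L : LCtx n m) (v : Term m) → IsValue v →
       es t (plugL L v) ↦ plugL L (rename (lift (wkL L)) t [0:= v ])

data _⟶_ : {n : ℕ} → Term n → Term n → Set where
  root : {n : ℕ} {t t' : Term n} → t ↦ t' → t ⟶ t'
  appR : {n : ℕ} {t u u' : Term n} → u ⟶ u' → app t u ⟶ app t u'
  appL : {n : ℕ} {t t' u : Term n} → t ⟶ t' → app t u ⟶ app t' u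
  esL  : {n : ℕ} {t t' : Term (suc n)} {u : Term n} → t ⟶ t' → es t u ⟶ es t' u
  esR  : {n : ℕ} {t : Term (suc n)} {u u' : Term n} → u ⟶ u' → es t u ⟶ es t u'

_⟶*_ : {n : ℕ} → Term n → Term n → Set
_⟶*_ = Star _⟶_

Normal : {n : ℕ} → Term n → Set
Normal t = ∀ t' → ¬ (t ⟶ t')

HasNF : {n : ℕ} → Term n → Set
HasNF t = ∃ λ s → (t ⟶* s) × Normal s

-- General contexts  C ::= ⟨·⟩ | t C | C t | λx.C | C[x←t] | t[x←C]
-- Ctx n m : outer scope n, hole scope m (plugging may capture).

data Ctx : ℕ → ℕ → Set where
  hole : {n : ℕ} → Ctx n n
  appR : {n m : ℕ} → Term n → Ctx n m → Ctx n m
  appL : {n m : ℕ} → Ctx n m → Term n → Ctx n m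
  lam  : {n m : ℕ} → Ctx (suc n) m → Ctx n m
  esL  : {n m : ℕ} → Ctx (suc n) m → Term n → Ctx n m
  esR  : {n m : ℕ} → Term (suc n) → Ctx n m → Ctx n m

plug : {n m : ℕ} → Ctx n m → Term m → Term n
plug hole       s = s
plug (appR t C) s = app t (plug C s)
plug (appL C t) s = app (plug C s) t
plug (lam C)    s = lam (plug C s)
plug (esL C t)  s = es (plug C s) t
plug (esR t C)  s = es t (plug C s)

_≾C_ : {n : ℕ} → Term n → Term n → Set
_≾C_ {n} t u = (C : Ctx 0 n) → HasNF (plug C t) → HasNF (plug C u)

-- Multi types.  Multisets are lists taken up to the (deep) permutation
-- equivalence ≈M below.

data Lin : Set where
  _⊸_ : List Lin → List Lin → Lin

MT : Set
MT = List Lin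

infix 4 _≈L_ _≈M_
mutual
  data _≈L_ : Lin → Lin → Set where
    ⊸-cong : {M M' N N' : MT} → M ≈M M' → N ≈M N' → (M ⊸ N) ≈L (M' ⊸ N')

  data _≈M_ : MT → MT → Set where
    []≈   : [] ≈M []
    _∷≈_  : {l l' : Lin} {M M' : MT} → l ≈L l' → M ≈M M' → (l ∷ M) ≈M (l' ∷ M')
    swap  : {l l' : Lin} {M : MT} → (l ∷ l' ∷ M) ≈M (l' ∷ l ∷ M)
    trans : {M M' M'' : MT} → M ≈M M' → M' ≈M M'' → M ≈M M''

-- typing contexts: every variable in scope gets a multi type ([] = absent)
TyCtx : ℕ → Set
TyCtx n = Fin n → MT

∅ : {n : ℕ} → TyCtx n
∅ _ = []

_⊎_ : {n : ℕ} → TyCtx n → TyCtx n → TyCtx n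
(Γ ⊎ Δ) x = Γ x ++ Δ x

single : {n : ℕ} → Fin n → Lin → TyCtx n
single x L y with x ≟ y
... | yes _ = L ∷ []
... | no  _ = []

_▸_ : {n : ℕ} → TyCtx n → MT → TyCtx (suc n)
(Γ ▸ M) zero    = M
(Γ ▸ M) (suc i) = Γ i

infix 3 _⊢ₗ_∶_ _⊢_∶_ _⊩_∶_
mutual
  data _⊢ₗ_∶_ {n : ℕ} : TyCtx n → Term n → Lin → Set where
    ax  : (x : Fin n) (L : Lin) → single x L ⊢ₗ var x ∶ L
    lam : {Γ : TyCtx n} {t : Term (suc n)} {M N : MT} →
          (Γ ▸ M) ⊢ t ∶ N → Γ ⊢ₗ lam t ∶ (M ⊸ N)

  data _⊩_∶_ {n : ℕ} : TyCtx n → Term n → MT → Set where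
    many[] : {v : Term n} → IsValue v → ∅ ⊩ v ∶ []
    many∷  : {Γ Δ : TyCtx n} {v : Term n} {L : Lin} {M : MT} →
             Γ ⊢ₗ v ∶ L → Δ ⊩ v ∶ M → (Γ ⊎ Δ) ⊩ v ∶ (L ∷ M)

  data _⊢_∶_ {n : ℕ} : TyCtx n → Term n → MT → Set where
    many : {Γ : TyCtx n} {v : Term n} {M : MT} → Γ ⊩ v ∶ M → Γ ⊢ v ∶ M
    app  : {Γ Δ : TyCtx n} {t u : Term n} {M N : MT} →
           Γ ⊢ t ∶ ((M ⊸ N) ∷ []) → Δ ⊢ u ∶ M → (Γ ⊎ Δ) ⊢ app t u ∶ N
    es   : {Γ Δ : TyCtx n} {t : Term (suc n)} {u : Term n} {M N : MT} →
           (Γ ▸ M) ⊢ t ∶ N → Δ ⊢ u ∶ M → (Γ ⊎ Δ) ⊢ es t u ∶ N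
    -- multisets are taken up to ≈M (quotient rendered as a conversion rule)
    conv : {Γ Γ' : TyCtx n} {t : Term n} {M M' : MT} →
           Γ ⊢ t ∶ M → (∀ x → Γ x ≈M Γ' x) → M ≈M M' → Γ' ⊢ t ∶ M'

_≾type_ : {n : ℕ} → Term n → Term n → Set
_≾type_ {n} t t' = (Γ : TyCtx n) (M : MT) → Γ ⊢ t ∶ M → Γ ⊢ t' ∶ M

-- Compatibility: every typing rule is syntax-directed up to the conversion rule, so a
-- derivation for C⟨t⟩ contains one for t at the hole, which can be swapped for one for t'.
--
-- Soundness: for closed terms, typability characterises normalisation.  A closed normal
-- form is an abstraction, typable with [], and typing is preserved backwards along →vsc.
-- Expanding a substitution step needs anti-substitution, proved for simultaneous
-- substitutions of values; the distant rules also shift terms across the substitution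
-- context L, which anti-renaming along injective renamings undoes.  Conversely, a
-- realizability interpretation of multi types shows that closed typable terms reduce to
-- values.  So if C⟨t⟩ normalises it is typable, hence so is C⟨t'⟩, which then normalises.

module Submission where

open import Defs
open import Algebra.Bundles using (CommutativeMonoid)
open import Algebra.Structures using (IsCommutativeMonoid)
import Algebra.Construct.Pointwise as Pointwise
import Algebra.Properties.CommutativeMonoid.Sum as CommutativeMonoidSum
import Algebra.Properties.CommutativeSemigroup as CommutativeSemigroupProperties
open import Data.Empty using (⊥; ⊥-elim)
open import Data.Fin using (Fin; zero; suc; _≟_; punchIn)
open import Data.Fin.Properties using (suc-injective; punchInᵢ≢i)
open import Data.List using ([]; _∷_; _++_)
open import Data.List.Relation.Binary.Permutation.Propositional using (_↭_)
import Data.List.Relation.Binary.Permutation.Propositional.Properties as ↭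
open import Data.Nat using (ℕ; zero; suc)
open import Data.Product using (∃; ∃₂; _×_; _,_; proj₁; proj₂)
open import Data.Unit using (⊤; tt)
open import Function using (id; _∘_; Injective; _⇔_; mk⇔; Equivalence)
open Equivalence using (to; from)
import Function.Properties.Equivalence as ⇔
open import Data.Product.Function.NonDependent.Propositional using (_×-⇔_)
open import Level using (0ℓ)
open import Relation.Binary.Structures using (IsEquivalence)
open import Relation.Binary.PropositionalEquality as ≡ using (_≡_; _≢_; _≗_; refl; cong; cong₂)
open import Relation.Binary.Construct.Closure.ReflexiveTransitive as Star using (_◅_; _◅◅_; gmap)
open import Relation.Nullary using (yes; no)

private variable
  n m k : ℕ
  M N : MT
  Γ Δ : TyCtx n
  Π Π' : TyCtx n
  σ : Fin n → Term m

-- Renaming and substitution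

lift-cong : {f g : Fin n → Fin m} → f ≗ g → lift f ≗ lift g
lift-cong f≗g zero    = refl
lift-cong f≗g (suc i) = cong suc (f≗g i)

rename-cong : {f g : Fin n → Fin m} → f ≗ g → rename f ≗ rename g
rename-cong f≗g (var x)   = cong var (f≗g x)
rename-cong f≗g (lam t)   = cong lam (rename-cong (lift-cong f≗g) t)
rename-cong f≗g (app t u) = cong₂ app (rename-cong f≗g t) (rename-cong f≗g u)
rename-cong f≗g (es t u)  = cong₂ es (rename-cong (lift-cong f≗g) t) (rename-cong f≗g u)

lift-id : lift {n} id ≗ id
lift-id zero    = refl
lift-id (suc i) = refl

rename-id : rename {n} id ≗ id
rename-id (var x)   = refl
rename-id (lam t)   = cong lam (≡.trans (rename-cong lift-id t) (rename-id t))
rename-id (app t u) = cong₂ app (rename-id t) (rename-id u)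
rename-id (es t u)  = cong₂ es (≡.trans (rename-cong lift-id t) (rename-id t)) (rename-id u)

rename-lift-id : rename {suc n} (lift id) ≗ id
rename-lift-id t = ≡.trans (rename-cong lift-id t) (rename-id t)

lift-∘ : (f : Fin m → Fin k) (g : Fin n → Fin m) → lift f ∘ lift g ≗ lift (f ∘ g)
lift-∘ f g zero    = refl
lift-∘ f g (suc i) = refl

rename-∘ : (f : Fin m → Fin k) (g : Fin n → Fin m) (t : Term n) →
           rename f (rename g t) ≡ rename (f ∘ g) t
rename-∘ f g (var x)   = refl
rename-∘ f g (lam t)   =
  cong lam (≡.trans (rename-∘ (lift f) (lift g) t) (rename-cong (lift-∘ f g) t))
rename-∘ f g (app t u) = cong₂ app (rename-∘ f g t) (rename-∘ f g u)
rename-∘ f g (es t u)  =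
  cong₂ es (≡.trans (rename-∘ (lift f) (lift g) t) (rename-cong (lift-∘ f g) t)) (rename-∘ f g u)

liftS-cong : {σ τ : Fin n → Term m} → σ ≗ τ → liftS σ ≗ liftS τ
liftS-cong σ≗τ zero    = refl
liftS-cong σ≗τ (suc i) = cong (rename suc) (σ≗τ i)

subst-cong : {σ τ : Fin n → Term m} → σ ≗ τ → subst σ ≗ subst τ
subst-cong σ≗τ (var x)   = σ≗τ x
subst-cong σ≗τ (lam t)   = cong lam (subst-cong (liftS-cong σ≗τ) t)
subst-cong σ≗τ (app t u) = cong₂ app (subst-cong σ≗τ t) (subst-cong σ≗τ u)
subst-cong σ≗τ (es t u)  = cong₂ es (subst-cong (liftS-cong σ≗τ) t) (subst-cong σ≗τ u)

liftS-var : {σ : Fin n → Term n} → σ ≗ var → liftS σ ≗ var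
liftS-var σ≗var zero    = refl
liftS-var σ≗var (suc i) = cong (rename suc) (σ≗var i)

subst-var : {σ : Fin n → Term n} → σ ≗ var → subst σ ≗ id
subst-var σ≗var (var x)   = σ≗var x
subst-var σ≗var (lam t)   = cong lam (subst-var (liftS-var σ≗var) t)
subst-var σ≗var (app t u) = cong₂ app (subst-var σ≗var t) (subst-var σ≗var u)
subst-var σ≗var (es t u)  = cong₂ es (subst-var (liftS-var σ≗var) t) (subst-var σ≗var u)

liftS-lift : (σ : Fin m → Term k) (f : Fin n → Fin m) → liftS σ ∘ lift f ≗ liftS (σ ∘ f)
liftS-lift σ f zero    = refl
liftS-lift σ f (suc i) = refl

subst-rename : (σ : Fin m → Term k) (f : Fin n → Fin m) (t : Term n) →
               subst σ (rename f t) ≡ subst (σ ∘ f) t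
subst-rename σ f (var x)   = refl
subst-rename σ f (lam t)   =
  cong lam (≡.trans (subst-rename (liftS σ) (lift f) t) (subst-cong (liftS-lift σ f) t))
subst-rename σ f (app t u) = cong₂ app (subst-rename σ f t) (subst-rename σ f u)
subst-rename σ f (es t u)  =
  cong₂ es (≡.trans (subst-rename (liftS σ) (lift f) t) (subst-cong (liftS-lift σ f) t))
           (subst-rename σ f u)

rename-liftS : (f : Fin m → Fin k) (σ : Fin n → Term m) →
               rename (lift f) ∘ liftS σ ≗ liftS (rename f ∘ σ)
rename-liftS f σ zero    = refl
rename-liftS f σ (suc i) = ≡.trans (rename-∘ (lift f) suc (σ i)) (≡.sym (rename-∘ suc f (σ i)))

rename-subst : (f : Fin m → Fin k) (σ : Fin n → Term m) (t : Term n) →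
               rename f (subst σ t) ≡ subst (rename f ∘ σ) t
rename-subst f σ (var x)   = refl
rename-subst f σ (lam t)   =
  cong lam (≡.trans (rename-subst (lift f) (liftS σ) t) (subst-cong (rename-liftS f σ) t))
rename-subst f σ (app t u) = cong₂ app (rename-subst f σ t) (rename-subst f σ u)
rename-subst f σ (es t u)  =
  cong₂ es (≡.trans (rename-subst (lift f) (liftS σ) t) (subst-cong (rename-liftS f σ) t))
           (rename-subst f σ u)

subst-liftS : (τ : Fin m → Term k) (σ : Fin n → Term m) →
              subst (liftS τ) ∘ liftS σ ≗ liftS (subst τ ∘ σ)
subst-liftS τ σ zero    = refl
subst-liftS τ σ (suc i) =
  ≡.trans (subst-rename (liftS τ) suc (σ i)) (≡.sym (rename-subst suc τ (σ i)))

subst-∘ : (τ : Fin m → Term k) (σ : Fin n → Term m) (t : Term n) →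
          subst τ (subst σ t) ≡ subst (subst τ ∘ σ) t
subst-∘ τ σ (var x)   = refl
subst-∘ τ σ (lam t)   =
  cong lam (≡.trans (subst-∘ (liftS τ) (liftS σ) t) (subst-cong (subst-liftS τ σ) t))
subst-∘ τ σ (app t u) = cong₂ app (subst-∘ τ σ t) (subst-∘ τ σ u)
subst-∘ τ σ (es t u)  =
  cong₂ es (≡.trans (subst-∘ (liftS τ) (liftS σ) t) (subst-cong (subst-liftS τ σ) t))
           (subst-∘ τ σ u)

infixl 5 _,ₛ_
_,ₛ_ : (Fin n → Term m) → Term m → Fin (suc n) → Term m
(σ ,ₛ v) zero    = v
(σ ,ₛ v) (suc i) = σ i

liftS-[0:=] : (σ : Fin n → Term m) (v : Term m) (t : Term (suc n)) →
              subst (liftS σ) t [0:= v ] ≡ subst (σ ,ₛ v) t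
liftS-[0:=] σ v t = ≡.trans (subst-∘ (sub0 v) (liftS σ) t) (subst-cong lemma t)
  where
  lemma : subst (sub0 v) ∘ liftS σ ≗ σ ,ₛ v
  lemma zero    = refl
  lemma (suc i) = ≡.trans (subst-rename (sub0 v) suc (σ i)) (subst-var (λ _ → refl) (σ i))

-- Multisets and typing contexts

mutual
  ≈L-refl : {l : Lin} → l ≈L l
  ≈L-refl {M ⊸ N} = ⊸-cong ≈M-refl ≈M-refl

  ≈M-refl : {M : MT} → M ≈M M
  ≈M-refl {[]}    = []≈
  ≈M-refl {l ∷ M} = ≈L-refl ∷≈ ≈M-refl

mutual
  ≈L-sym : {l l' : Lin} → l ≈L l' → l' ≈L l
  ≈L-sym (⊸-cong M≈M' N≈N') = ⊸-cong (≈M-sym M≈M') (≈M-sym N≈N')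

  ≈M-sym : {M M' : MT} → M ≈M M' → M' ≈M M
  ≈M-sym []≈                 = []≈
  ≈M-sym (l≈l' ∷≈ M≈M')      = ≈L-sym l≈l' ∷≈ ≈M-sym M≈M'
  ≈M-sym swap                = swap
  ≈M-sym (trans M≈M' M'≈M'') = trans (≈M-sym M'≈M'') (≈M-sym M≈M')

≈M-isEquivalence : IsEquivalence _≈M_
≈M-isEquivalence = record { refl = ≈M-refl ; sym = ≈M-sym ; trans = trans }

≡⇒≈M : {M N : MT} → M ≡ N → M ≈M N
≡⇒≈M refl = ≈M-refl

↭⇒≈M : {M N : MT} → M ↭ N → M ≈M N
↭⇒≈M _↭_.refl          = ≈M-refl
↭⇒≈M (_↭_.prep l p)    = ≈L-refl ∷≈ ↭⇒≈M p
↭⇒≈M (_↭_.swap l l' p) = trans swap (≈L-refl ∷≈ (≈L-refl ∷≈ ↭⇒≈M p))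
↭⇒≈M (_↭_.trans p q)   = trans (↭⇒≈M p) (↭⇒≈M q)

++-congˡ : (A : MT) {B B' : MT} → B ≈M B' → A ++ B ≈M A ++ B'
++-congˡ []      B≈B' = B≈B'
++-congˡ (l ∷ A) B≈B' = ≈L-refl ∷≈ ++-congˡ A B≈B'

++-cong : {A A' B B' : MT} → A ≈M A' → B ≈M B' → A ++ B ≈M A' ++ B'
++-cong []≈                 B≈B' = B≈B'
++-cong (l≈l' ∷≈ A≈A')      B≈B' = l≈l' ∷≈ ++-cong A≈A' B≈B'
++-cong (swap {M = A})      B≈B' = trans swap (≈L-refl ∷≈ (≈L-refl ∷≈ ++-congˡ A B≈B'))
++-cong (trans A≈A' A'≈A'') B≈B' = trans (++-cong A≈A' B≈B') (++-cong A'≈A'' ≈M-refl)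

++-commutativeMonoid : CommutativeMonoid 0ℓ 0ℓ
++-commutativeMonoid = record
  { isCommutativeMonoid = record
    { isMonoid = record
      { isSemigroup = record
        { isMagma = record { isEquivalence = ≈M-isEquivalence ; ∙-cong = ++-cong }
        ; assoc   = λ A B C → ↭⇒≈M (Perm.assoc A B C)
        }
      ; identity = (λ A → ↭⇒≈M (proj₁ Perm.identity A)) , (λ A → ↭⇒≈M (proj₂ Perm.identity A))
      }
    ; comm = λ A B → ↭⇒≈M (Perm.comm A B)
    }
  }
  where module Perm = IsCommutativeMonoid (↭.++-isCommutativeMonoid {A = Lin})

module _ {c ℓ} (M : CommutativeMonoid c ℓ) where
  open CommutativeMonoid M
  open CommutativeMonoidSum M using (sum; sum-remove; sum-cong-≋; sum-replicate-zero)
  open import Relation.Binary.Reasoning.Setoid setoid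

  sum-one-hot : (f : Fin k → Carrier) (x : Fin k) → (∀ i → i ≢ x → f i ≈ ε) → sum f ≈ f x
  sum-one-hot {suc k} f x vanish = begin
    sum f                           ≈⟨ sum-remove f ⟩
    f x ∙ sum (f ∘ punchIn x)       ≈⟨ ∙-congˡ (sum-cong-≋ (λ i → vanish _ (punchInᵢ≢i x i))) ⟩
    f x ∙ sum {k} (λ _ → ε)         ≈⟨ ∙-congˡ (sum-replicate-zero k) ⟩
    f x ∙ ε                         ≈⟨ identityʳ (f x) ⟩
    f x                             ∎

module Multiset where
  open CommutativeMonoid ++-commutativeMonoid public
  open CommutativeMonoidSum ++-commutativeMonoid public
    using (sum; sum-cong-≋; sum-replicate-zero; ∑-distrib-+)

infix 4 _≈c_
_≈c_ : TyCtx n → TyCtx n → Set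
Γ ≈c Δ = ∀ x → Γ x ≈M Δ x

module Context {n : ℕ} where
  open CommutativeMonoid (Pointwise.commutativeMonoid (Fin n) ++-commutativeMonoid) public
  open CommutativeSemigroupProperties commutativeSemigroup public

▸-η : (Γ : TyCtx (suc n)) {P : MT} → Γ zero ≈M P → Γ ≈c (Γ ∘ suc) ▸ P
▸-η Γ Γ₀≈P zero    = Γ₀≈P
▸-η Γ Γ₀≈P (suc i) = ≈M-refl

⨄ : (Fin k → TyCtx n) → TyCtx n
⨄ F z = Multiset.sum (λ i → F i z)

⨄-cong : {F G : Fin k → TyCtx n} → (∀ i → F i ≈c G i) → ⨄ F ≈c ⨄ G
⨄-cong F≈G z = Multiset.sum-cong-≋ (λ i → F≈G i z)

⨄-⊎ : (F G : Fin k → TyCtx n) → ⨄ (λ i → F i ⊎ G i) ≈c ⨄ F ⊎ ⨄ G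
⨄-⊎ F G z = Multiset.∑-distrib-+ (λ i → F i z) (λ i → G i z)

⨄-∅ : ⨄ {k} {n} (λ _ → ∅) ≈c ∅
⨄-∅ {k} z = Multiset.sum-replicate-zero k

⨄-vanishing : (F : Fin k → TyCtx n) (z : Fin n) → (∀ i → F i z ≈M []) → ⨄ F z ≈M []
⨄-vanishing {k} F z vanish =
  trans (Multiset.sum-cong-≋ vanish) (Multiset.sum-replicate-zero k)

point : Fin n → MT → TyCtx n
point x N y with x ≟ y
... | yes _ = N
... | no  _ = []

point-self : (x : Fin n) (N : MT) → point x N x ≡ N
point-self x N with x ≟ x
... | yes _  = refl
... | no x≢x = ⊥-elim (x≢x refl)

single-self : (x : Fin n) (L : Lin) → single x L x ≡ L ∷ []
single-self x L with x ≟ x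
... | yes _  = refl
... | no x≢x = ⊥-elim (x≢x refl)

point-other : {x y : Fin n} (N : MT) → x ≢ y → point x N y ≡ []
point-other {x = x} {y} N x≢y with x ≟ y
... | yes x≡y = ⊥-elim (x≢y x≡y)
... | no  _   = refl

point-cong : (x : Fin n) {N N' : MT} → N ≈M N' → point x N ≈c point x N'
point-cong x N≈N' y with x ≟ y
... | yes _ = N≈N'
... | no  _ = []≈

point-[] : (x : Fin n) → ∅ ≗ point x []
point-[] x y with x ≟ y
... | yes _ = refl
... | no  _ = refl

single-⊎-point : (x : Fin n) (L : Lin) (N : MT) → single x L ⊎ point x N ≗ point x (L ∷ N)
single-⊎-point x L N y with x ≟ y
... | yes _ = refl
... | no  _ = refl

point-rename : {ρ : Fin n → Fin m} → Injective _≡_ _≡_ ρ →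
               (x : Fin n) (N : MT) → point (ρ x) N ∘ ρ ≗ point x N
point-rename {ρ = ρ} ρ-inj x N z with x ≟ z | ρ x ≟ ρ z
... | yes _    | yes _     = refl
... | yes refl | no ρx≢ρx  = ⊥-elim (ρx≢ρx refl)
... | no x≢z   | yes ρx≡ρz = ⊥-elim (x≢z (ρ-inj ρx≡ρz))
... | no _     | no _      = refl

⨄-point : (N : Fin n → MT) → ⨄ (λ i → point i (N i)) ≈c N
⨄-point N z =
  trans (sum-one-hot ++-commutativeMonoid _ z (λ i i≢z → ≡⇒≈M (point-other (N i) i≢z)))
        (≡⇒≈M (point-self z (N z)))

-- Inversion and compatibility

value-inv : {v : Term n} → IsValue v → Γ ⊢ v ∶ N →
            ∃₂ λ Γ' N' → Γ' ⊩ v ∶ N' × Γ' ≈c Γ × N' ≈M N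
value-inv v-val (many d) = _ , _ , d , Context.refl , ≈M-refl
value-inv v-val (conv d Γ≈ N≈) =
  let Γ' , N' , d' , Γ'≈ , N'≈ = value-inv v-val d in
  Γ' , N' , d' , Context.trans Γ'≈ Γ≈ , trans N'≈ N≈

app-inv : {t u : Term n} → Γ ⊢ app t u ∶ N →
          ∃₂ λ Γ₁ Δ₁ → ∃ λ P → Γ₁ ⊢ t ∶ (P ⊸ N) ∷ [] × Δ₁ ⊢ u ∶ P × Γ₁ ⊎ Δ₁ ≈c Γ
app-inv (many (many[] ()))
app-inv (many (many∷ () _))
app-inv (app d₁ d₂) = _ , _ , _ , d₁ , d₂ , Context.refl
app-inv (conv d Γ≈ N≈) =
  let Γ₁ , Δ₁ , P , d₁ , d₂ , split = app-inv d in
  Γ₁ , Δ₁ , P , conv d₁ Context.refl (⊸-cong ≈M-refl N≈ ∷≈ []≈) , d₂ , Context.trans split Γ≈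

es-inv : {t : Term (suc n)} {u : Term n} → Γ ⊢ es t u ∶ N →
         ∃₂ λ Γ₁ Δ₁ → ∃ λ P → Γ₁ ▸ P ⊢ t ∶ N × Δ₁ ⊢ u ∶ P × Γ₁ ⊎ Δ₁ ≈c Γ
es-inv (many (many[] ()))
es-inv (many (many∷ () _))
es-inv (es d₁ d₂) = _ , _ , _ , d₁ , d₂ , Context.refl
es-inv (conv d Γ≈ N≈) =
  let Γ₁ , Δ₁ , P , d₁ , d₂ , split = es-inv d in
  Γ₁ , Δ₁ , P , conv d₁ Context.refl N≈ , d₂ , Context.trans split Γ≈

⊩-var : (x : Fin n) (N : MT) → ∃ λ Γ → Γ ⊩ var x ∶ N
⊩-var x []      = ∅ , many[] (var x)
⊩-var x (L ∷ N) = _ , many∷ (ax x L) (proj₂ (⊩-var x N))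

⊩-var-point : {x : Fin n} → Γ ⊩ var x ∶ N → Γ ≗ point x N
⊩-var-point {x = x} (many[] _) = point-[] x
⊩-var-point {x = x} (many∷ (ax x L) d) y =
  ≡.trans (cong (single x L y ++_) (⊩-var-point d y)) (single-⊎-point x L _ y)

⊢-var : (x : Fin n) (N : MT) → point x N ⊢ var x ∶ N
⊢-var x N = let _ , d = ⊩-var x N in conv (many d) (≡⇒≈M ∘ ⊩-var-point d) ≈M-refl

var-inv : {x : Fin n} → Γ ⊢ var x ∶ N → Γ ≈c point x N
var-inv {x = x} d =
  let _ , _ , d' , Γ'≈Γ , N'≈N = value-inv (var x) d in
  λ y → trans (≈M-sym (Γ'≈Γ y)) (trans (≡⇒≈M (⊩-var-point d' y)) (point-cong x N'≈N y))

⊢-lam : {t : Term (suc n)} → Γ ▸ M ⊢ t ∶ N → Γ ⊢ lam t ∶ (M ⊸ N) ∷ []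
⊢-lam {Γ = Γ} d = conv (many (many∷ (lam d) (many[] (lam _)))) (Context.identityʳ Γ) ≈M-refl

⊢-value-[] : {v : Term n} → IsValue v → ∅ ⊢ v ∶ []
⊢-value-[] v-val = many (many[] v-val)

⊩-++ : {v : Term n} {A B : MT} → Γ ⊩ v ∶ A → Δ ⊩ v ∶ B → ∃ λ Θ → Θ ⊩ v ∶ A ++ B × Θ ≈c Γ ⊎ Δ
⊩-++ (many[] _) d = _ , d , Context.refl
⊩-++ {Δ = Δ} (many∷ {Γ = Γ₁} {Δ = Γ₂} dₗ d₁) d₂ =
  let Θ , d , Θ≈ = ⊩-++ d₁ d₂ in
  Γ₁ ⊎ Θ , many∷ dₗ d , Context.trans (Context.∙-congˡ Θ≈) (Context.sym (Context.assoc Γ₁ Γ₂ Δ))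

⊢-value-++ : {v : Term n} {A B : MT} → IsValue v → Γ ⊢ v ∶ A → Δ ⊢ v ∶ B → Γ ⊎ Δ ⊢ v ∶ A ++ B
⊢-value-++ v-val d₁ d₂ =
  let _ , _ , d₁' , Γ≈ , A≈ = value-inv v-val d₁
      _ , _ , d₂' , Δ≈ , B≈ = value-inv v-val d₂
      _ , d , Θ≈ = ⊩-++ d₁' d₂'
  in conv (many d) (Context.trans Θ≈ (Context.∙-cong Γ≈ Δ≈)) (++-cong A≈ B≈)

≾type-app : {t t' u u' : Term n} → t ≾type t' → u ≾type u' → app t u ≾type app t' u'
≾type-app t≾t' u≾u' Γ N d =
  let Γ₁ , Δ₁ , P , d₁ , d₂ , split = app-inv d in
  conv (app (t≾t' Γ₁ _ d₁) (u≾u' Δ₁ P d₂)) split ≈M-refl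

≾type-es : {t t' : Term (suc n)} {u u' : Term n} → t ≾type t' → u ≾type u' → es t u ≾type es t' u'
≾type-es t≾t' u≾u' Γ N d =
  let Γ₁ , Δ₁ , P , d₁ , d₂ , split = es-inv d in
  conv (es (t≾t' (Γ₁ ▸ P) N d₁) (u≾u' Δ₁ P d₂)) split ≈M-refl

≾type-lam : {t t' : Term (suc n)} → t ≾type t' → lam t ≾type lam t'
≾type-lam {t = t} {t'} t≾t' Γ N d =
  let _ , _ , d' , Γ'≈Γ , N'≈N = value-inv (lam t) d in
  conv (many (⊩-lam d')) Γ'≈Γ N'≈N
  where
  ⊩-lam : {Γ : TyCtx _} {N : MT} → Γ ⊩ lam t ∶ N → Γ ⊩ lam t' ∶ N
  ⊩-lam (many[] _)         = many[] (lam t')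
  ⊩-lam (many∷ (lam d) ds) = many∷ (lam (t≾t' _ _ d)) (⊩-lam ds)

≾type-refl : {t : Term n} → t ≾type t
≾type-refl Γ N d = d

≾type-plug : (C : Ctx n m) {t t' : Term m} → t ≾type t' → plug C t ≾type plug C t'
≾type-plug hole       t≾t' = t≾t'
≾type-plug (appR s C) t≾t' = ≾type-app ≾type-refl (≾type-plug C t≾t')
≾type-plug (appL C s) t≾t' = ≾type-app (≾type-plug C t≾t') ≾type-refl
≾type-plug (lam C)    t≾t' = ≾type-lam (≾type-plug C t≾t')
≾type-plug (esL C s)  t≾t' = ≾type-es (≾type-plug C t≾t') ≾type-refl
≾type-plug (esR s C)  t≾t' = ≾type-es ≾type-refl (≾type-plug C t≾t')

-- Subject expansion

≗⇒≈c : Γ ≗ Δ → Γ ≈c Δ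
≗⇒≈c Γ≗Δ = ≡⇒≈M ∘ Γ≗Δ

▸-lift : (Γ : TyCtx m) (P : MT) (ρ : Fin n → Fin m) → (Γ ▸ P) ∘ lift ρ ≗ (Γ ∘ ρ) ▸ P
▸-lift Γ P ρ zero    = refl
▸-lift Γ P ρ (suc i) = refl

lift-injective : {ρ : Fin n → Fin m} → Injective _≡_ _≡_ ρ → Injective _≡_ _≡_ (lift ρ)
lift-injective ρ-inj {zero}  {zero}  _  = refl
lift-injective ρ-inj {suc x} {suc y} eq = cong suc (ρ-inj (suc-injective eq))

SupportedOn : (Fin n → Fin m) → TyCtx m → Set
SupportedOn ρ Γ = ∀ y → (∀ x → ρ x ≢ y) → Γ y ≈M []

∉-image-lift : {ρ : Fin n → Fin m} {y : Fin m} → (∀ x → ρ x ≢ y) → ∀ x → lift ρ x ≢ suc y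
∉-image-lift y∉ρ zero    ()
∉-image-lift y∉ρ (suc x) eq = y∉ρ x (suc-injective eq)

rename-inv : {ρ : Fin n → Fin m} → Injective _≡_ _≡_ ρ → (t : Term n) →
             Γ ⊢ rename ρ t ∶ N → Γ ∘ ρ ⊢ t ∶ N × SupportedOn ρ Γ
rename-inv {N = N} {ρ = ρ} ρ-inj (var x) d =
  let Γ≈ = var-inv d in
  conv (⊢-var x N) (λ z → ≈M-sym (trans (Γ≈ (ρ z)) (≡⇒≈M (point-rename ρ-inj x N z)))) ≈M-refl ,
  λ y y∉ρ → trans (Γ≈ y) (≡⇒≈M (point-other N (y∉ρ x)))
rename-inv {ρ = ρ} ρ-inj (app t u) d =
  let _ , _ , _ , d₁ , d₂ , split = app-inv d
      d₁' , supp₁ = rename-inv ρ-inj t d₁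
      d₂' , supp₂ = rename-inv ρ-inj u d₂
  in conv (app d₁' d₂') (split ∘ ρ) ≈M-refl ,
     λ y y∉ρ → trans (≈M-sym (split y)) (++-cong (supp₁ y y∉ρ) (supp₂ y y∉ρ))
rename-inv {ρ = ρ} ρ-inj (es t u) d =
  let Γ₁ , _ , P , d₁ , d₂ , split = es-inv d
      d₁' , supp₁ = rename-inv (lift-injective ρ-inj) t d₁
      d₂' , supp₂ = rename-inv ρ-inj u d₂
  in conv (es (conv d₁' (≗⇒≈c (▸-lift Γ₁ P ρ)) ≈M-refl) d₂') (split ∘ ρ) ≈M-refl ,
     λ y y∉ρ → trans (≈M-sym (split y))
                     (++-cong (supp₁ (suc y) (∉-image-lift y∉ρ)) (supp₂ y y∉ρ))
rename-inv {ρ = ρ} ρ-inj (lam t) d =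
  let _ , _ , d' , Γ'≈Γ , N'≈N = value-inv (lam _) d
      d'' , supp = ⊩-lam-inv d'
  in conv (many d'') (Γ'≈Γ ∘ ρ) N'≈N , λ y y∉ρ → trans (≈M-sym (Γ'≈Γ y)) (supp y y∉ρ)
  where
  ⊩-lam-inv : Γ ⊩ lam (rename (lift ρ) t) ∶ N → Γ ∘ ρ ⊩ lam t ∶ N × SupportedOn ρ Γ
  ⊩-lam-inv (many[] _) = many[] (lam t) , λ _ _ → []≈
  ⊩-lam-inv (many∷ {Γ = Γ₁} (lam {M = P} d) ds) =
    let d' , supp₁ = rename-inv (lift-injective ρ-inj) t d
        ds' , supp₂ = ⊩-lam-inv ds
    in many∷ (lam (conv d' (≗⇒≈c (▸-lift Γ₁ P ρ)) ≈M-refl)) ds' ,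
       λ y y∉ρ → ++-cong (supp₁ (suc y) (∉-image-lift y∉ρ)) (supp₂ y y∉ρ)

Values : (Fin n → Term m) → Set
Values σ = ∀ i → IsValue (σ i)

rename-value : (ρ : Fin n → Fin m) {v : Term n} → IsValue v → IsValue (rename ρ v)
rename-value ρ (var x) = var (ρ x)
rename-value ρ (lam t) = lam _

subst-value : (σ : Fin n → Term m) → Values σ → {v : Term n} → IsValue v → IsValue (subst σ v)
subst-value σ σ-val (var x) = σ-val x
subst-value σ σ-val (lam t) = lam _

liftS-values : {σ : Fin n → Term m} → Values σ → Values (liftS σ)
liftS-values σ-val zero    = var zero
liftS-values σ-val (suc i) = rename-value suc (σ-val i)

infix 3 _⊢ˢ_∶_
_⊢ˢ_∶_ : TyCtx m → (Fin n → Term m) → TyCtx n → Set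
_⊢ˢ_∶_ {n = n} Γ σ Π = ∃ λ (Δ : Fin n → TyCtx _) → (∀ i → Δ i ⊢ σ i ∶ Π i) × Γ ≈c ⨄ Δ

⊢ˢ-∅ : {σ : Fin n → Term m} → Values σ → ∅ ⊢ˢ σ ∶ ∅
⊢ˢ-∅ {n = n} σ-val = (λ _ → ∅) , (λ i → ⊢-value-[] (σ-val i)) , Context.sym (⨄-∅ {n})

⊢ˢ-⊎ : Values σ → Γ ⊢ˢ σ ∶ Π → Δ ⊢ˢ σ ∶ Π' → Γ ⊎ Δ ⊢ˢ σ ∶ Π ⊎ Π'
⊢ˢ-⊎ σ-val (Δ₁ , typed₁ , Γ≈) (Δ₂ , typed₂ , Δ≈) =
  (λ i → Δ₁ i ⊎ Δ₂ i) ,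
  (λ i → ⊢-value-++ (σ-val i) (typed₁ i) (typed₂ i)) ,
  Context.trans (Context.∙-cong Γ≈ Δ≈) (Context.sym (⨄-⊎ Δ₁ Δ₂))

⊢ˢ-resp : Γ ≈c Δ → Γ ⊢ˢ σ ∶ Π → Δ ⊢ˢ σ ∶ Π
⊢ˢ-resp Γ≈Δ (Δs , typed , Γ≈) = Δs , typed , Context.trans (Context.sym Γ≈Δ) Γ≈

⊢ˢ-liftS-inv : {Γ : TyCtx m} {σ : Fin n → Term m} {P : MT} {Π : TyCtx (suc n)} →
               Γ ▸ P ⊢ˢ liftS σ ∶ Π → Γ ⊢ˢ σ ∶ Π ∘ suc × P ≈M Π zero
⊢ˢ-liftS-inv {Γ = Γ} {σ} {P} {Π} (Δ , typed , Γ▸P≈) =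
  ((λ i → Δ (suc i) ∘ suc) , proj₁ ∘ strengthened , Γ≈) , P≈
  where
  Δ₀≈ : Δ zero ≈c point zero (Π zero)
  Δ₀≈ = var-inv (typed zero)

  strengthened : ∀ i → Δ (suc i) ∘ suc ⊢ σ i ∶ Π (suc i) × SupportedOn suc (Δ (suc i))
  strengthened i = rename-inv suc-injective (σ i) (typed (suc i))

  Γ≈ : Γ ≈c ⨄ (λ i → Δ (suc i) ∘ suc)
  Γ≈ y = trans (Γ▸P≈ (suc y)) (++-cong (Δ₀≈ (suc y)) ≈M-refl)

  P≈ : P ≈M Π zero
  P≈ = trans (Γ▸P≈ zero)
         (trans (++-cong (Δ₀≈ zero)
                         (⨄-vanishing (Δ ∘ suc) zero λ i → proj₂ (strengthened i) zero λ _ ()))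
                (Multiset.identityʳ (Π zero)))

subst-inv : (t : Term n) → Values σ → Γ ⊢ subst σ t ∶ N → ∃ λ Π → Π ⊢ t ∶ N × Γ ⊢ˢ σ ∶ Π
subst-inv {n = n} {σ = σ} {Γ = Γ} {N = N} (var x) σ-val d =
  point x N , ⊢-var x N , (λ i z → point x (Γ z) i) , typed ,
  λ z → ≈M-sym (trans (sum-one-hot ++-commutativeMonoid _ x
                        (λ i i≢x → ≡⇒≈M (point-other (Γ z) (i≢x ∘ ≡.sym))))
                      (≡⇒≈M (point-self x (Γ z))))
  where
  typed : ∀ i → (λ z → point x (Γ z) i) ⊢ σ i ∶ point x N i
  typed i with x ≟ i
  ... | yes refl = d
  ... | no  _    = ⊢-value-[] (σ-val i)
subst-inv (app t u) σ-val d =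
  let _ , _ , _ , d₁ , d₂ , split = app-inv d
      Π₁ , t∶ , σ∶Π₁ = subst-inv t σ-val d₁
      Π₂ , u∶ , σ∶Π₂ = subst-inv u σ-val d₂
  in Π₁ ⊎ Π₂ , app t∶ u∶ , ⊢ˢ-resp split (⊢ˢ-⊎ σ-val σ∶Π₁ σ∶Π₂)
subst-inv (es t u) σ-val d =
  let _ , _ , _ , d₁ , d₂ , split = es-inv d
      Π₁ , t∶ , σ∶Π₁ = subst-inv t (liftS-values σ-val) d₁
      σ∶Π₁∘suc , P≈ = ⊢ˢ-liftS-inv σ∶Π₁
      Π₂ , u∶ , σ∶Π₂ = subst-inv u σ-val d₂
  in (Π₁ ∘ suc) ⊎ Π₂ ,
     es (conv t∶ (▸-η Π₁ ≈M-refl) ≈M-refl) (conv u∶ Context.refl P≈) ,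
     ⊢ˢ-resp split (⊢ˢ-⊎ σ-val σ∶Π₁∘suc σ∶Π₂)
subst-inv {σ = σ} (lam t) σ-val d =
  let _ , _ , d' , Γ'≈Γ , N'≈N = value-inv (lam _) d
      Π , t∶ , σ∶Π = ⊩-lam-inv d'
  in Π , conv (many t∶) Context.refl N'≈N , ⊢ˢ-resp Γ'≈Γ σ∶Π
  where
  ⊩-lam-inv : Γ ⊩ lam (subst (liftS σ) t) ∶ N → ∃ λ Π → Π ⊩ lam t ∶ N × Γ ⊢ˢ σ ∶ Π
  ⊩-lam-inv (many[] _) = ∅ , many[] (lam t) , ⊢ˢ-∅ σ-val
  ⊩-lam-inv (many∷ (lam dₗ) ds) =
    let Π₁ , t∶ , σ∶Π₁ = subst-inv t (liftS-values σ-val) dₗ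
        σ∶Π₁∘suc , P≈ = ⊢ˢ-liftS-inv σ∶Π₁
        Π₂ , ds' , σ∶Π₂ = ⊩-lam-inv ds
    in (Π₁ ∘ suc) ⊎ Π₂ , many∷ (lam (conv t∶ (▸-η Π₁ (≈M-sym P≈)) ≈M-refl)) ds' ,
       ⊢ˢ-⊎ σ-val σ∶Π₁∘suc σ∶Π₂

sub0-values : {v : Term n} → IsValue v → Values (sub0 v)
sub0-values v-val zero    = v-val
sub0-values v-val (suc i) = var i

[0:=]-inv : {t : Term (suc n)} {v : Term n} → IsValue v → Γ ⊢ t [0:= v ] ∶ N →
            ∃₂ λ Π Δ → Π ⊢ t ∶ N × Δ ⊢ v ∶ Π zero × Γ ≈c Δ ⊎ (Π ∘ suc)
[0:=]-inv {t = t} v-val d =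
  let Π , t∶ , (Δ , typed , Γ≈) = subst-inv t (sub0-values v-val) d
  in Π , Δ zero , t∶ , typed zero ,
     Context.trans Γ≈ (Context.∙-congˡ (Context.trans (⨄-cong (var-inv ∘ typed ∘ suc))
                                                       (⨄-point (Π ∘ suc))))

dB-expand : (L : LCtx n m) (t : Term (suc m)) (u : Term n) →
            Γ ⊢ plugL L (es t (rename (wkL L) u)) ∶ N → Γ ⊢ app (plugL L (lam t)) u ∶ N
dB-expand hole t u d rewrite rename-id u =
  let _ , _ , _ , d₁ , d₂ , split = es-inv d in
  conv (app (⊢-lam d₁) d₂) split ≈M-refl
dB-expand (esL L s) t u d rewrite ≡.sym (rename-∘ (wkL L) suc u) =
  let Γ₁ , Δ₁ , P , d₁ , s∶ , split = es-inv d
      Γ₂ , Δ₂ , Q , λt∶ , u∶ , split₂ = app-inv (dB-expand L t (rename suc u) d₁)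
      u∶' , supp = rename-inv suc-injective u u∶
      P≈ = trans (≈M-sym (split₂ zero))
                 (trans (++-cong ≈M-refl (supp zero λ _ ())) (Multiset.identityʳ (Γ₂ zero)))
  in conv (app (es (conv λt∶ (▸-η Γ₂ ≈M-refl) ≈M-refl) (conv s∶ Context.refl P≈)) u∶')
          (Context.trans (Context.xy∙z≈xz∙y (Γ₂ ∘ suc) Δ₁ (Δ₂ ∘ suc))
                         (Context.trans (Context.∙-congʳ (split₂ ∘ suc)) split))
          ≈M-refl

ls-expand : (t : Term (suc n)) (L : LCtx n m) {v : Term m} → IsValue v →
            Γ ⊢ plugL L (rename (lift (wkL L)) t [0:= v ]) ∶ N → Γ ⊢ es t (plugL L v) ∶ N
ls-expand t hole v-val d rewrite rename-lift-id t =
  let Π , Δ , t∶ , v∶ , Γ≈ = [0:=]-inv v-val d in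
  conv (es (conv t∶ (▸-η Π ≈M-refl) ≈M-refl) v∶)
       (Context.trans (Context.comm (Π ∘ suc) Δ) (Context.sym Γ≈))
       ≈M-refl
ls-expand t (esL L s) v-val d
  rewrite ≡.sym (rename-cong (lift-∘ (wkL L) suc) t)
        | ≡.sym (rename-∘ (lift (wkL L)) (lift suc) t) =
  let Γ₁ , Δ₁ , P , d₁ , s∶ , split = es-inv d
      Γ₂ , Δ₂ , Q , t∶ , L⟨v⟩∶ , split₂ = es-inv (ls-expand (rename (lift suc) t) L v-val d₁)
      t∶' , supp = rename-inv (lift-injective suc-injective) t t∶
      P≈ = trans (≈M-sym (split₂ zero))
                 (++-cong (supp (suc zero) λ { zero () ; (suc _) () }) ≈M-refl)
  in conv (es (conv t∶' (≗⇒≈c (▸-lift Γ₂ Q suc)) ≈M-refl)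
              (es (conv L⟨v⟩∶ (▸-η Δ₂ ≈M-refl) ≈M-refl) (conv s∶ Context.refl P≈)))
          (Context.trans (Context.sym (Context.assoc (Γ₂ ∘ suc) (Δ₂ ∘ suc) Δ₁))
                         (Context.trans (Context.∙-congʳ (split₂ ∘ suc)) split))
          ≈M-refl

⟶-expand : {t t' : Term n} → t ⟶ t' → Γ ⊢ t' ∶ N → Γ ⊢ t ∶ N
⟶-expand (root (dB L t u))       d = dB-expand L t u d
⟶-expand (root (ls t L v v-val)) d = ls-expand t L v-val d
⟶-expand (appR r) d =
  let _ , _ , _ , d₁ , d₂ , split = app-inv d in conv (app d₁ (⟶-expand r d₂)) split ≈M-refl
⟶-expand (appL r) d =
  let _ , _ , _ , d₁ , d₂ , split = app-inv d in conv (app (⟶-expand r d₁) d₂) split ≈M-refl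
⟶-expand (esL r) d =
  let _ , _ , _ , d₁ , d₂ , split = es-inv d in conv (es (⟶-expand r d₁) d₂) split ≈M-refl
⟶-expand (esR r) d =
  let _ , _ , _ , d₁ , d₂ , split = es-inv d in conv (es d₁ (⟶-expand r d₂)) split ≈M-refl

⟶*-expand : {t t' : Term n} → t ⟶* t' → Γ ⊢ t' ∶ N → Γ ⊢ t ∶ N
⟶*-expand Star.ε       d = d
⟶*-expand (r ◅ steps) d = ⟶-expand r (⟶*-expand steps d)

-- Adequacy and soundness

⟶-dB : {s : Term (suc n)} {u : Term n} → app (lam s) u ⟶ es s u
⟶-dB {s = s} {u} = ≡.subst (λ u' → app (lam s) u ⟶ es s u') (rename-id u) (root (dB hole s u))

⟶-ls : {s : Term (suc n)} {v : Term n} → IsValue v → es s v ⟶ (s [0:= v ])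
⟶-ls {s = s} {v} v-val =
  ≡.subst (λ s' → es s v ⟶ (s' [0:= v ])) (rename-lift-id s) (root (ls s hole v v-val))

⟶*-appˡ : {t t' u : Term n} → t ⟶* t' → app t u ⟶* app t' u
⟶*-appˡ = gmap _ appL

⟶*-appʳ : {t u u' : Term n} → u ⟶* u' → app t u ⟶* app t u'
⟶*-appʳ = gmap _ appR

⟶*-esʳ : {t : Term (suc n)} {u u' : Term n} → u ⟶* u' → es t u ⟶* es t u'
⟶*-esʳ = gmap _ esR

mutual
  ⟦_⟧ₗ : Lin → Term 0 → Set
  ⟦ M ⊸ N ⟧ₗ (lam s)   = (v : Term 0) → IsValue v → ⟦ M ⟧ₘ v → Evaluates N (s [0:= v ])
  ⟦ _ ⟧ₗ     (var ())
  ⟦ _ ⟧ₗ     (app _ _) = ⊥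
  ⟦ _ ⟧ₗ     (es _ _)  = ⊥

  ⟦_⟧ₘ : MT → Term 0 → Set
  ⟦ [] ⟧ₘ    v = ⊤
  ⟦ l ∷ M ⟧ₘ v = ⟦ l ⟧ₗ v × ⟦ M ⟧ₘ v

  Evaluates : MT → Term 0 → Set
  Evaluates N t = ∃ λ w → t ⟶* w × IsValue w × ⟦ N ⟧ₘ w

mutual
  ⟦⟧ₗ-cong : {l l' : Lin} → l ≈L l' → (w : Term 0) → ⟦ l ⟧ₗ w ⇔ ⟦ l' ⟧ₗ w
  ⟦⟧ₗ-cong (⊸-cong M≈ N≈) (lam s) = mk⇔
    (λ f v v-val v⊨ → to (Evaluates-cong N≈ _) (f v v-val (from (⟦⟧ₘ-cong M≈ v) v⊨)))
    (λ f v v-val v⊨ → from (Evaluates-cong N≈ _) (f v v-val (to (⟦⟧ₘ-cong M≈ v) v⊨)))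
  ⟦⟧ₗ-cong (⊸-cong _ _)   (var ())
  ⟦⟧ₗ-cong (⊸-cong _ _)   (app _ _) = mk⇔ id id
  ⟦⟧ₗ-cong (⊸-cong _ _)   (es _ _)  = mk⇔ id id

  ⟦⟧ₘ-cong : {M M' : MT} → M ≈M M' → (w : Term 0) → ⟦ M ⟧ₘ w ⇔ ⟦ M' ⟧ₘ w
  ⟦⟧ₘ-cong []≈                 w = mk⇔ id id
  ⟦⟧ₘ-cong (l≈l' ∷≈ M≈M')      w = ⟦⟧ₗ-cong l≈l' w ×-⇔ ⟦⟧ₘ-cong M≈M' w
  ⟦⟧ₘ-cong swap                w = mk⇔ (λ (p , q , r) → q , p , r) (λ (p , q , r) → q , p , r)
  ⟦⟧ₘ-cong (trans M≈M' M'≈M'') w = ⇔.trans (⟦⟧ₘ-cong M≈M' w) (⟦⟧ₘ-cong M'≈M'' w)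

  Evaluates-cong : {N N' : MT} → N ≈M N' → (t : Term 0) → Evaluates N t ⇔ Evaluates N' t
  Evaluates-cong N≈N' t = mk⇔
    (λ (w , steps , w-val , w⊨) → w , steps , w-val , to (⟦⟧ₘ-cong N≈N' w) w⊨)
    (λ (w , steps , w-val , w⊨) → w , steps , w-val , from (⟦⟧ₘ-cong N≈N' w) w⊨)

⟦⟧ₘ-++ : (A : MT) {B : MT} {w : Term 0} → ⟦ A ++ B ⟧ₘ w → ⟦ A ⟧ₘ w × ⟦ B ⟧ₘ w
⟦⟧ₘ-++ []      w⊨ = tt , w⊨
⟦⟧ₘ-++ (l ∷ A) (l⊨ , w⊨) = let A⊨ , B⊨ = ⟦⟧ₘ-++ A w⊨ in (l⊨ , A⊨) , B⊨

infix 4 _⊨_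
_⊨_ : (Fin n → Term 0) → TyCtx n → Set
σ ⊨ Γ = ∀ x → IsValue (σ x) × ⟦ Γ x ⟧ₘ (σ x)

⊨-⊎ : {σ : Fin n → Term 0} → σ ⊨ Γ ⊎ Δ → σ ⊨ Γ × σ ⊨ Δ
⊨-⊎ {Γ = Γ} σ⊨ =
  (λ x → proj₁ (σ⊨ x) , proj₁ (⟦⟧ₘ-++ (Γ x) (proj₂ (σ⊨ x)))) ,
  (λ x → proj₁ (σ⊨ x) , proj₂ (⟦⟧ₘ-++ (Γ x) (proj₂ (σ⊨ x))))

⊨-resp : {σ : Fin n → Term 0} → Γ ≈c Δ → σ ⊨ Δ → σ ⊨ Γ
⊨-resp {σ = σ} Γ≈Δ σ⊨ x = proj₁ (σ⊨ x) , from (⟦⟧ₘ-cong (Γ≈Δ x) (σ x)) (proj₂ (σ⊨ x))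

⊨-,ₛ : {σ : Fin n → Term 0} {v : Term 0} → σ ⊨ Γ → IsValue v → ⟦ M ⟧ₘ v → σ ,ₛ v ⊨ Γ ▸ M
⊨-,ₛ σ⊨ v-val v⊨ zero    = v-val , v⊨
⊨-,ₛ σ⊨ v-val v⊨ (suc x) = σ⊨ x

mutual
  adequacy : {t : Term n} {σ : Fin n → Term 0} → Γ ⊢ t ∶ N → σ ⊨ Γ → Evaluates N (subst σ t)
  adequacy (many d) σ⊨ = let v-val , v⊨ = adequacy-⊩ d σ⊨ in _ , Star.ε , v-val , v⊨
  adequacy (app d₁ d₂) σ⊨ with adequacy d₁ (proj₁ (⊨-⊎ σ⊨)) | adequacy d₂ (proj₂ (⊨-⊎ σ⊨))
  ... | lam s , t⟶*λs , _ , (λs⊨ , _) | v , u⟶*v , v-val , v⊨ =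
    let w , s[v]⟶*w , w-val , w⊨ = λs⊨ v v-val v⊨ in
    w , ⟶*-appˡ t⟶*λs ◅◅ ⟶*-appʳ u⟶*v ◅◅ ⟶-dB ◅ ⟶-ls v-val ◅ s[v]⟶*w , w-val , w⊨
  ... | var () , _ | _
  ... | app _ _ , _ , _ , () , _ | _
  ... | es _ _  , _ , _ , () , _ | _
  adequacy {σ = σ} (es {t = t} d₁ d₂) σ⊨ =
    let σ⊨Γ , σ⊨Δ = ⊨-⊎ σ⊨
        v , u⟶*v , v-val , v⊨ = adequacy d₂ σ⊨Δ
        w , t⟶*w , w-val , w⊨ = adequacy d₁ (⊨-,ₛ σ⊨Γ v-val v⊨)
    in w , ⟶*-esʳ u⟶*v ◅◅ ⟶-ls v-val ◅ ≡.subst (_⟶* w) (≡.sym (liftS-[0:=] σ v t)) t⟶*w ,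
       w-val , w⊨
  adequacy (conv d Γ≈ N≈) σ⊨ = to (Evaluates-cong N≈ _) (adequacy d (⊨-resp Γ≈ σ⊨))

  adequacy-⊩ : {v : Term n} {σ : Fin n → Term 0} → Γ ⊩ v ∶ N → σ ⊨ Γ →
               IsValue (subst σ v) × ⟦ N ⟧ₘ (subst σ v)
  adequacy-⊩ {σ = σ} (many[] v-val) σ⊨ = subst-value σ (proj₁ ∘ σ⊨) v-val , tt
  adequacy-⊩ (many∷ dₗ d) σ⊨ =
    let σ⊨Γ , σ⊨Δ = ⊨-⊎ σ⊨
        v-val , v⊨ = adequacy-⊩ d σ⊨Δ
    in v-val , adequacy-⊢ₗ dₗ σ⊨Γ , v⊨

  adequacy-⊢ₗ : {v : Term n} {L : Lin} {σ : Fin n → Term 0} →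
                Γ ⊢ₗ v ∶ L → σ ⊨ Γ → ⟦ L ⟧ₗ (subst σ v)
  adequacy-⊢ₗ {σ = σ} (ax x L) σ⊨ =
    proj₁ (≡.subst (λ M → ⟦ M ⟧ₘ (σ x)) (single-self x L) (proj₂ (σ⊨ x)))
  adequacy-⊢ₗ {σ = σ} (lam {t = t} d) σ⊨ v v-val v⊨ =
    ≡.subst (Evaluates _) (≡.sym (liftS-[0:=] σ v t)) (adequacy d (⊨-,ₛ σ⊨ v-val v⊨))

value-normal : {v : Term n} → IsValue v → Normal v
value-normal (var x) _ (root ())
value-normal (lam t) _ (root ())

closed-normal-value : (s : Term 0) → Normal s → IsValue s
closed-normal-value (var ())
closed-normal-value (lam s) _ = lam s
closed-normal-value (app s u) s-nf with closed-normal-value s (λ s' r → s-nf _ (appL r))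
... | var ()
... | lam s' = ⊥-elim (s-nf _ ⟶-dB)
closed-normal-value (es s u) s-nf with closed-normal-value u (λ u' r → s-nf _ (esR r))
... | var ()
... | lam u' = ⊥-elim (s-nf _ (⟶-ls (lam u')))

closed-typable⇒HasNF : {t : Term 0} → ∅ ⊢ t ∶ N → HasNF t
closed-typable⇒HasNF {t = t} d =
  let w , t⟶*w , w-val , _ = adequacy {σ = λ ()} d (λ ()) in
  w , ≡.subst (_⟶* w) (subst-var (λ ()) t) t⟶*w , value-normal w-val

closed-HasNF⇒typable : {t : Term 0} → HasNF t → ∅ ⊢ t ∶ []
closed-HasNF⇒typable (s , t⟶*s , s-nf) = ⟶*-expand t⟶*s (⊢-value-[] (closed-normal-value s s-nf))

≾type⇒≾C : {t t' : Term n} → t ≾type t' → t ≾C t'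
≾type⇒≾C t≾t' C C⟨t⟩↓ =
  closed-typable⇒HasNF (≾type-plug C t≾t' ∅ [] (closed-HasNF⇒typable C⟨t⟩↓))

proposition12p4 :
    ({n m : ℕ} (C : Ctx n m) (t t' : Term m) → t ≾type t' → plug C t ≾type plug C t')
    × ({n : ℕ} (t t' : Term n) → t ≾type t' → t ≾C t')
proposition12p4 = (λ C t t' → ≾type-plug C) , (λ t t' → ≾type⇒≾C)
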